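{- Among all trees of order $n$, $h(G)$ is maximized by the star $S_n$ and minimized by the path $P_n$. Moreover, the second smallest value of $h$ among trees of order $n$ is attained by any tree with exactly $3$ leaves.
   Context: $h(G)=\sum_i f(d_i)$ where $(d_i)$ is the degree sequence of $G$ and $f(x)=x\log x$. -}

module Defs where

open import Data.Nat using (ℕ; zero; suc; _+_; _^_; _≤_; _≡ᵇ_)
open import Data.Bool using (Bool; true; false; if_then_else_; _∧_; _∨_; not)
open import Data.Fin using (Fin; toℕ)
open import Data.List using (List; []; _∷_; _++_; length; map; allFin)
open import Data.Nat.ListAction using (sum; product)
open import Data.List.Relation.Unary.Linked using (Linked)
open import Data.List.Relation.Unary.Unique.Propositional using (Unique)
open import Data.Product using (Σ; _×_; ∃-syntax)
open import Relation.Nullary using (¬_)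
open import Relation.Binary.PropositionalEquality using (_≡_; refl)
open import Data.Bool.Properties using (∨-comm)

open import Relation.Binary.Construct.Closure.ReflexiveTransitive using (Star)

record Graph (n : ℕ) : Set where
  field
    adj    : Fin n → Fin n → Bool
    sym    : ∀ i j → adj i j ≡ adj j i
    irrefl : ∀ i → adj i i ≡ false
open Graph public

Adj : ∀ {n} → Graph n → Fin n → Fin n → Set
Adj G i j = adj G i j ≡ true

degree : ∀ {n} → Graph n → Fin n → ℕ
degree {n} G i = sum (map (λ j → if adj G i j then 1 else 0) (allFin n))

leaves : ∀ {n} → Graph n → ℕ
leaves {n} G = sum (map (λ i → if degree G i ≡ᵇ 1 then 1 else 0) (allFin n))

-- H G = ∏_i d_i ^ d_i  (with 0^0 = 1), so that h(G) = Σ_i d_i log d_i = log (H G).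
H : ∀ {n} → Graph n → ℕ
H {n} G = product (map (λ i → degree G i ^ degree G i) (allFin n))

Connected : ∀ {n} → Graph n → Set
Connected G = ∀ i j → Star (Adj G) i j

HasCycle : ∀ {n} → Graph n → Set
HasCycle {n} G = ∃[ x ] ∃[ ys ]
  (2 ≤ length ys × Unique (x ∷ ys) × Linked (Adj G) (x ∷ ys ++ x ∷ []))

IsTree : ∀ {n} → Graph n → Set
IsTree G = Connected G × ¬ HasCycle G

starAdj : ∀ {n} → Fin n → Fin n → Bool
starAdj i j = not (toℕ i ≡ᵇ toℕ j) ∧ ((toℕ i ≡ᵇ 0) ∨ (toℕ j ≡ᵇ 0))

pathAdj : ∀ {n} → Fin n → Fin n → Bool
pathAdj i j = (suc (toℕ i) ≡ᵇ toℕ j) ∨ (suc (toℕ j) ≡ᵇ toℕ i)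

≡ᵇ-sym : ∀ a b → (a ≡ᵇ b) ≡ (b ≡ᵇ a)
≡ᵇ-sym zero zero = refl
≡ᵇ-sym zero (suc b) = refl
≡ᵇ-sym (suc a) zero = refl
≡ᵇ-sym (suc a) (suc b) = ≡ᵇ-sym a b

≡ᵇ-refl : ∀ a → (a ≡ᵇ a) ≡ true
≡ᵇ-refl zero = refl
≡ᵇ-refl (suc a) = ≡ᵇ-refl a

suc≢ᵇ : ∀ a → (suc a ≡ᵇ a) ≡ false
suc≢ᵇ zero = refl
suc≢ᵇ (suc a) = suc≢ᵇ a

star : (m : ℕ) → Graph (suc m)
star m = record { adj = starAdj ; sym = s ; irrefl = ir }
  where
  s : ∀ i j → starAdj i j ≡ starAdj j i
  s i j rewrite ≡ᵇ-sym (toℕ i) (toℕ j) | ∨-comm (toℕ i ≡ᵇ 0) (toℕ j ≡ᵇ 0) = refl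
  ir : ∀ i → starAdj i i ≡ false
  ir i rewrite ≡ᵇ-refl (toℕ i) = refl

path : (m : ℕ) → Graph (suc m)
path m = record { adj = pathAdj ; sym = s ; irrefl = ir }
  where
  s : ∀ i j → pathAdj i j ≡ pathAdj j i
  s i j = ∨-comm (suc (toℕ i) ≡ᵇ toℕ j) (suc (toℕ j) ≡ᵇ toℕ i)
  ir : ∀ i → pathAdj i i ≡ false
  ir i rewrite suc≢ᵇ (toℕ i) = refl

-- Write the degrees of a tree on m + 2 vertices as dᵢ = 1 + eᵢ; the handshake
-- lemma (proved by pruning leaves) gives Σ eᵢ = m.  By Bernoulli's inequality
-- (1+a)^(1+a) (1+b)^(1+b) ≤ (1+a+b)^(1+a+b), so H = ∏ dᵢ^dᵢ only grows when
-- excess is moved onto one vertex, and the star, carrying all of it, is the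
-- maximum.  In the other direction (1+e)^(1+e) ≥ 4^e with equality iff e ≤ 1,
-- so H ≥ 4^m with equality when all degrees are ≤ 2, as for the path, while a
-- vertex of degree ≥ 3 raises H to at least 27/16 · 4^m.  Three leaves force
-- exactly one vertex of degree 3 and all other degrees ≤ 2, so such a tree
-- attains 27/16 · 4^m, which is therefore the second smallest value.

module Submission where

open import Defs hiding (sym)
open import Data.Nat using (ℕ; zero; suc; _+_; _*_; _∸_; _^_; _≤_; _<_; _≡ᵇ_; _≤?_; z≤n; s≤s)
open import Data.Nat.Properties hiding (_≟_)
open import Data.Nat.ListAction using (sum; product)
open import Data.Nat.Tactic.RingSolver using (solve-∀)
open import Data.Bool using (Bool; true; false; if_then_else_; _∧_; _∨_; not; T)
import Data.Bool as Bool
open import Data.Bool.Properties using (if-float; ∧-zeroʳ)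
open import Data.Unit using (tt)
open import Data.Fin using (Fin; zero; suc; toℕ)
open import Data.Fin.Properties using (_≟_; any?; injective⇒≤; toℕ-injective)
open import Data.List using (List; []; _∷_; _++_; length; lookup; map; allFin; tabulate)
open import Data.List.Properties using (++-assoc; length-++-≤ʳ; map-tabulate; map-∘; length-map; length-tabulate)
open import Data.List.Membership.Propositional using (_∈_)
open import Data.List.Membership.Propositional.Properties using (∈-lookup; ∈-∃++)
open import Data.List.Relation.Unary.All as All using (All; []; _∷_; all?)
open import Data.List.Relation.Unary.All.Properties using (++⁻ˡ; map⁺; tabulate⁺; ¬All⇒Any¬; ¬Any⇒All¬)
open import Data.List.Relation.Unary.Any as Any using (Any; here; there)
open import Data.List.Relation.Unary.Linked as Linked using (Linked; [-]; _∷_)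
open import Data.List.Relation.Unary.Unique.Propositional using (Unique; []; _∷_)
open import Data.Product using (∃; ∃₂; _×_; _,_; proj₁; proj₂)
open import Data.Sum using (_⊎_; inj₁; inj₂; swap)
open import Function using (_∘_; id; flip)
open import Level using (0ℓ)
open import Relation.Binary.Core using (Rel)
open import Relation.Binary.PropositionalEquality
open import Relation.Binary.Construct.Closure.ReflexiveTransitive using (Star; ε; _◅_; _◅◅_; gmap; reverse)
open import Relation.Nullary using (¬_; yes; no; does; contradiction; ¬?; _×-dec_)
open import Relation.Nullary.Decidable using (decidable-stable)
open import Algebra.Properties.CommutativeSemigroup *-commutativeSemigroup using (x∙yz≈y∙xz; xy∙z≈y∙xz)
open import Algebra.Properties.CommutativeMonoid.Sum +-0-commutativeMonoid
  using (sum-cong-≗; ∑-distrib-+) renaming (sum to ∑)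

-- Self powers and degree sequences

selfPow : ℕ → ℕ
selfPow d = d ^ d

bernoulli : ∀ n x y → x ^ n * (x + suc n * y) ≤ (x + y) ^ suc n
bernoulli zero x y = ≤-reflexive (base x y)
  where
  base : ∀ x y → 1 * (x + 1 * y) ≡ (x + y) * 1
  base = solve-∀
bernoulli (suc n) x y = begin
    x * x ^ n * (x + suc (suc n) * y)
  ≡⟨ xy∙z≈y∙xz x (x ^ n) (x + suc (suc n) * y) ⟩
    x ^ n * (x * (x + suc (suc n) * y))
  ≤⟨ *-monoʳ-≤ (x ^ n) (≤-trans (m≤m+n _ (suc n * y * y)) (≤-reflexive (key x y n))) ⟩
    x ^ n * ((x + y) * (x + suc n * y))
  ≡⟨ x∙yz≈y∙xz (x ^ n) (x + y) (x + suc n * y) ⟩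
    (x + y) * (x ^ n * (x + suc n * y))
  ≤⟨ *-monoʳ-≤ (x + y) (bernoulli n x y) ⟩
    (x + y) * (x + y) ^ suc n ∎
  where
  open ≤-Reasoning
  key : ∀ x y n → x * (x + suc (suc n) * y) + suc n * y * y ≡ (x + y) * (x + suc n * y)
  key = solve-∀

selfPow-superadditive : ∀ a b → selfPow (suc a) * selfPow (suc b) ≤ selfPow (suc (a + b))
selfPow-superadditive a b = begin
    suc a * suc a ^ a * (suc b * suc b ^ b)
  ≡⟨ regroup a b (suc a ^ a) (suc b ^ b) ⟩
    suc a ^ a * (suc a + suc a * b) * suc b ^ b
  ≤⟨ *-monoˡ-≤ (suc b ^ b) (bernoulli a (suc a) b) ⟩
    (suc a + b) ^ suc a * suc b ^ b
  ≤⟨ *-monoʳ-≤ ((suc a + b) ^ suc a) (^-monoˡ-≤ b (s≤s (m≤n+m b a))) ⟩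
    (suc a + b) ^ suc a * (suc a + b) ^ b
  ≡⟨ ^-distribˡ-+-* (suc a + b) (suc a) b ⟨
    suc (a + b) ^ suc (a + b) ∎
  where
  open ≤-Reasoning
  regroup : ∀ a b p q → suc a * p * (suc b * q) ≡ p * (suc a + suc a * b) * q
  regroup = solve-∀

4^n≤selfPow[1+n] : ∀ n → 4 ^ n ≤ selfPow (suc n)
4^n≤selfPow[1+n] 0 = s≤s z≤n
4^n≤selfPow[1+n] 1 = ≤-refl
4^n≤selfPow[1+n] 2 = m≤m+n 16 11
4^n≤selfPow[1+n] n@(suc (suc (suc _))) =
  ≤-trans (^-monoˡ-≤ n (s≤s (s≤s (s≤s (s≤s z≤n))))) (m≤n*m (suc n ^ n) (suc n))

27*4^n≤16*selfPow[1+n] : ∀ n → 2 ≤ n → 27 * 4 ^ n ≤ 16 * selfPow (suc n)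
27*4^n≤16*selfPow[1+n] 0 ()
27*4^n≤16*selfPow[1+n] 1 (s≤s ())
27*4^n≤16*selfPow[1+n] 2 _ = ≤-refl
27*4^n≤16*selfPow[1+n] n@(suc (suc (suc _))) _ = begin
    27 * 4 ^ n
  ≤⟨ *-mono-≤ (≤-trans (m≤m+n 27 37) (*-monoʳ-≤ 16 4≤1+n)) (^-monoˡ-≤ n 4≤1+n) ⟩
    16 * suc n * suc n ^ n
  ≡⟨ *-assoc 16 (suc n) (suc n ^ n) ⟩
    16 * suc n ^ suc n ∎
  where
  open ≤-Reasoning
  4≤1+n : 4 ≤ suc n
  4≤1+n = s≤s (s≤s (s≤s (s≤s z≤n)))

∏selfPow : List ℕ → ℕ
∏selfPow ds = product (map selfPow ds)

excess : List ℕ → ℕ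
excess = sum ∘ map (_∸ 1)

excess₂ : List ℕ → ℕ
excess₂ = sum ∘ map (_∸ 2)

ones : List ℕ → ℕ
ones = sum ∘ map (λ d → if d ≡ᵇ 1 then 1 else 0)

Positive : List ℕ → Set
Positive = All (1 ≤_)

∏selfPow≤selfPow[1+excess] : ∀ ds → Positive ds → ∏selfPow ds ≤ selfPow (suc (excess ds))
∏selfPow≤selfPow[1+excess] [] [] = s≤s z≤n
∏selfPow≤selfPow[1+excess] (suc e ∷ ds) (_ ∷ pos) =
  ≤-trans (*-monoʳ-≤ (selfPow (suc e)) (∏selfPow≤selfPow[1+excess] ds pos))
          (selfPow-superadditive e (excess ds))

4^excess≤∏selfPow : ∀ ds → Positive ds → 4 ^ excess ds ≤ ∏selfPow ds
4^excess≤∏selfPow [] [] = ≤-refl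
4^excess≤∏selfPow (suc e ∷ ds) (_ ∷ pos) = begin
    4 ^ (e + excess ds)
  ≡⟨ ^-distribˡ-+-* 4 e (excess ds) ⟩
    4 ^ e * 4 ^ excess ds
  ≤⟨ *-mono-≤ (4^n≤selfPow[1+n] e) (4^excess≤∏selfPow ds pos) ⟩
    selfPow (suc e) * ∏selfPow ds ∎
  where open ≤-Reasoning

∏selfPow≤4^excess : ∀ ds → All (_≤ 2) ds → ∏selfPow ds ≤ 4 ^ excess ds
∏selfPow≤4^excess [] [] = ≤-refl
∏selfPow≤4^excess (0 ∷ ds) (_ ∷ ds≤2) = ≤-trans (≤-reflexive (+-identityʳ (∏selfPow ds))) (∏selfPow≤4^excess ds ds≤2)
∏selfPow≤4^excess (1 ∷ ds) (_ ∷ ds≤2) = ≤-trans (≤-reflexive (+-identityʳ (∏selfPow ds))) (∏selfPow≤4^excess ds ds≤2)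
∏selfPow≤4^excess (2 ∷ ds) (_ ∷ ds≤2) = *-monoʳ-≤ 4 (∏selfPow≤4^excess ds ds≤2)
∏selfPow≤4^excess (suc (suc (suc _)) ∷ _) (s≤s (s≤s ()) ∷ _)

27*4^excess≤16*∏selfPow : ∀ ds → Positive ds → Any (3 ≤_) ds →
                          27 * 4 ^ excess ds ≤ 16 * ∏selfPow ds
27*4^excess≤16*∏selfPow (suc e ∷ ds) (_ ∷ pos) (here (s≤s 2≤e)) = begin
    27 * 4 ^ (e + excess ds)
  ≡⟨ cong (27 *_) (^-distribˡ-+-* 4 e (excess ds)) ⟩
    27 * (4 ^ e * 4 ^ excess ds)
  ≡⟨ *-assoc 27 (4 ^ e) _ ⟨
    27 * 4 ^ e * 4 ^ excess ds
  ≤⟨ *-mono-≤ (27*4^n≤16*selfPow[1+n] e 2≤e) (4^excess≤∏selfPow ds pos) ⟩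
    16 * selfPow (suc e) * ∏selfPow ds
  ≡⟨ *-assoc 16 (selfPow (suc e)) _ ⟩
    16 * (selfPow (suc e) * ∏selfPow ds) ∎
  where open ≤-Reasoning
27*4^excess≤16*∏selfPow (suc e ∷ ds) (_ ∷ pos) (there big) = begin
    27 * 4 ^ (e + excess ds)
  ≡⟨ cong (27 *_) (^-distribˡ-+-* 4 e (excess ds)) ⟩
    27 * (4 ^ e * 4 ^ excess ds)
  ≡⟨ x∙yz≈y∙xz 27 (4 ^ e) (4 ^ excess ds) ⟩
    4 ^ e * (27 * 4 ^ excess ds)
  ≤⟨ *-mono-≤ (4^n≤selfPow[1+n] e) (27*4^excess≤16*∏selfPow ds pos big) ⟩
    selfPow (suc e) * (16 * ∏selfPow ds)
  ≡⟨ x∙yz≈y∙xz (selfPow (suc e)) 16 (∏selfPow ds) ⟩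
    16 * (selfPow (suc e) * ∏selfPow ds) ∎
  where open ≤-Reasoning

excess₂≡0⇒All≤2 : ∀ ds → excess₂ ds ≡ 0 → All (_≤ 2) ds
excess₂≡0⇒All≤2 [] _ = []
excess₂≡0⇒All≤2 (0 ∷ ds) e = z≤n ∷ excess₂≡0⇒All≤2 ds e
excess₂≡0⇒All≤2 (1 ∷ ds) e = s≤s z≤n ∷ excess₂≡0⇒All≤2 ds e
excess₂≡0⇒All≤2 (2 ∷ ds) e = ≤-refl ∷ excess₂≡0⇒All≤2 ds e

excess₂≡1⇒Any3≤ : ∀ ds → excess₂ ds ≡ 1 → Any (3 ≤_) ds
excess₂≡1⇒Any3≤ (0 ∷ ds) e = there (excess₂≡1⇒Any3≤ ds e)
excess₂≡1⇒Any3≤ (1 ∷ ds) e = there (excess₂≡1⇒Any3≤ ds e)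
excess₂≡1⇒Any3≤ (2 ∷ ds) e = there (excess₂≡1⇒Any3≤ ds e)
excess₂≡1⇒Any3≤ (3 ∷ ds) e = here ≤-refl

16*∏selfPow≤27*4^excess : ∀ ds → excess₂ ds ≡ 1 → 16 * ∏selfPow ds ≤ 27 * 4 ^ excess ds
16*∏selfPow≤27*4^excess (0 ∷ ds) e =
  ≤-trans (≤-reflexive (cong (16 *_) (+-identityʳ (∏selfPow ds)))) (16*∏selfPow≤27*4^excess ds e)
16*∏selfPow≤27*4^excess (1 ∷ ds) e =
  ≤-trans (≤-reflexive (cong (16 *_) (+-identityʳ (∏selfPow ds)))) (16*∏selfPow≤27*4^excess ds e)
16*∏selfPow≤27*4^excess (2 ∷ ds) e = begin
    16 * (4 * ∏selfPow ds)
  ≡⟨ x∙yz≈y∙xz 16 4 (∏selfPow ds) ⟩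
    4 * (16 * ∏selfPow ds)
  ≤⟨ *-monoʳ-≤ 4 (16*∏selfPow≤27*4^excess ds e) ⟩
    4 * (27 * 4 ^ excess ds)
  ≡⟨ x∙yz≈y∙xz 4 27 (4 ^ excess ds) ⟩
    27 * (4 * 4 ^ excess ds) ∎
  where open ≤-Reasoning
16*∏selfPow≤27*4^excess (3 ∷ ds) e = begin
    16 * (27 * ∏selfPow ds)
  ≤⟨ *-monoʳ-≤ 16 (*-monoʳ-≤ 27 (∏selfPow≤4^excess ds ds≤2)) ⟩
    16 * (27 * 4 ^ excess ds)
  ≡⟨ trans (x∙yz≈y∙xz 16 27 (4 ^ excess ds)) (cong (27 *_) (*-assoc 4 4 (4 ^ excess ds))) ⟩
    27 * (4 * (4 * 4 ^ excess ds)) ∎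
  where
  open ≤-Reasoning
  ds≤2 = excess₂≡0⇒All≤2 ds (suc-injective e)

sum≡excess+length : ∀ ds → Positive ds → sum ds ≡ excess ds + length ds
sum≡excess+length [] [] = refl
sum≡excess+length (suc e ∷ ds) (_ ∷ pos) = begin
    suc e + sum ds
  ≡⟨ cong (suc e +_) (sum≡excess+length ds pos) ⟩
    suc e + (excess ds + length ds)
  ≡⟨ cong suc (+-assoc e (excess ds) (length ds)) ⟨
    suc (e + excess ds + length ds)
  ≡⟨ +-suc (e + excess ds) (length ds) ⟨
    e + excess ds + suc (length ds) ∎
  where open ≡-Reasoning

excess+ones≡excess₂+length : ∀ ds → Positive ds →
                             excess ds + ones ds ≡ excess₂ ds + length ds
excess+ones≡excess₂+length [] [] = refl
excess+ones≡excess₂+length (1 ∷ ds) (_ ∷ pos) = begin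
    excess ds + suc (ones ds)
  ≡⟨ +-suc (excess ds) (ones ds) ⟩
    suc (excess ds + ones ds)
  ≡⟨ cong suc (excess+ones≡excess₂+length ds pos) ⟩
    suc (excess₂ ds + length ds)
  ≡⟨ +-suc (excess₂ ds) (length ds) ⟨
    excess₂ ds + suc (length ds) ∎
  where open ≡-Reasoning
excess+ones≡excess₂+length (suc (suc k) ∷ ds) (_ ∷ pos) = begin
    suc k + excess ds + ones ds
  ≡⟨ +-assoc (suc k) (excess ds) (ones ds) ⟩
    suc k + (excess ds + ones ds)
  ≡⟨ cong (suc k +_) (excess+ones≡excess₂+length ds pos) ⟩
    suc k + (excess₂ ds + length ds)
  ≡⟨ cong suc (+-assoc k (excess₂ ds) (length ds)) ⟨
    suc (k + excess₂ ds + length ds)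
  ≡⟨ +-suc (k + excess₂ ds) (length ds) ⟨
    k + excess₂ ds + suc (length ds) ∎
  where open ≡-Reasoning

1≤selfPow : ∀ d → 1 ≤ selfPow d
1≤selfPow zero = ≤-refl
1≤selfPow (suc d) = m^n>0 (suc d) (suc d)

1≤∏selfPow : ∀ ds → 1 ≤ ∏selfPow ds
1≤∏selfPow [] = ≤-refl
1≤∏selfPow (d ∷ ds) = *-mono-≤ (1≤selfPow d) (1≤∏selfPow ds)

𝟙 : Bool → ℕ
𝟙 b = if b then 1 else 0

𝟙-positive : ∀ b → 0 < 𝟙 b → b ≡ true
𝟙-positive true _ = refl

sum-allFin : ∀ {n} (f : Fin n → ℕ) → sum (map f (allFin n)) ≡ ∑ f
sum-allFin {n} f = trans (cong sum (map-tabulate id f)) (sum-tabulate n f)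
  where
  sum-tabulate : ∀ n (f : Fin n → ℕ) → sum (tabulate f) ≡ ∑ f
  sum-tabulate zero f = refl
  sum-tabulate (suc n) f = cong (f zero +_) (sum-tabulate n (λ j → f (suc j)))

∑-const-1 : ∀ n → ∑ {n} (λ _ → 1) ≡ n
∑-const-1 zero = refl
∑-const-1 (suc n) = cong suc (∑-const-1 n)

∑-zero : ∀ {n} {f : Fin n → ℕ} → (∀ j → f j ≡ 0) → ∑ f ≡ 0
∑-zero {zero} f≡0 = refl
∑-zero {suc n} f≡0 = cong₂ _+_ (f≡0 zero) (∑-zero (λ j → f≡0 (suc j)))

∑-mono-≤ : ∀ {n} {f g : Fin n → ℕ} → (∀ j → f j ≤ g j) → ∑ f ≤ ∑ g
∑-mono-≤ {zero} f≤g = z≤n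
∑-mono-≤ {suc n} f≤g = +-mono-≤ (f≤g zero) (∑-mono-≤ (λ j → f≤g (suc j)))

∑-positive : ∀ {n} (f : Fin n → ℕ) → 0 < ∑ f → ∃ λ j → 0 < f j
∑-positive {suc n} f 0<∑ with f zero in eq
... | suc _ = zero , subst (0 <_) (sym eq) (s≤s z≤n)
... | zero with ∑-positive (λ j → f (suc j)) 0<∑
...   | j , 0<fj = suc j , 0<fj

∑-delta : ∀ {n} (a : Fin n) (c : ℕ) → ∑ (λ j → if does (j ≟ a) then c else 0) ≡ c
∑-delta {suc n} zero c = trans (cong (c +_) (∑-zero {n} {λ _ → 0} (λ _ → refl))) (+-identityʳ c)
∑-delta {suc n} (suc a) c = ∑-delta a c

∑-split-at : ∀ {n} (f : Fin n → ℕ) a →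
             ∑ f ≡ f a + ∑ (λ j → if does (j ≟ a) then 0 else f j)
∑-split-at f a = begin
    ∑ f
  ≡⟨ sum-cong-≗ split ⟩
    ∑ (λ j → at-a j + off-a j)
  ≡⟨ ∑-distrib-+ at-a off-a ⟩
    ∑ at-a + ∑ off-a
  ≡⟨ cong (_+ ∑ off-a) (∑-delta a (f a)) ⟩
    f a + ∑ off-a ∎
  where
  open ≡-Reasoning
  at-a off-a : Fin _ → ℕ
  at-a j = if does (j ≟ a) then f a else 0
  off-a j = if does (j ≟ a) then 0 else f j
  split : ∀ j → f j ≡ at-a j + off-a j
  split j with j ≟ a
  ... | yes refl = sym (+-identityʳ (f j))
  ... | no _ = refl

∑-point : ∀ {n} (f : Fin n → ℕ) a → f a ≤ ∑ f
∑-point f a = subst (f a ≤_) (sym (∑-split-at f a)) (m≤m+n (f a) _)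

∑-two-points : ∀ {n} (f : Fin n → ℕ) {a b} → a ≢ b → f a + f b ≤ ∑ f
∑-two-points f {a} {b} a≢b = subst (f a + f b ≤_) (sym (∑-split-at f a))
  (+-monoʳ-≤ (f a) (subst (_≤ _) fb (∑-point (λ j → if does (j ≟ a) then 0 else f j) b)))
  where
  fb : (if does (b ≟ a) then 0 else f b) ≡ f b
  fb with b ≟ a
  ... | yes refl = contradiction refl a≢b
  ... | no _ = refl

Unique⇒lookup-injective : ∀ {A : Set} {xs : List A} → Unique xs →
                          ∀ {i j} → lookup xs i ≡ lookup xs j → i ≡ j
Unique⇒lookup-injective (_ ∷ _) {zero} {zero} _ = refl
Unique⇒lookup-injective (x∉ ∷ _) {zero} {suc j} eq = contradiction eq (All.lookup x∉ (∈-lookup j))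
Unique⇒lookup-injective (x∉ ∷ _) {suc i} {zero} eq = contradiction (sym eq) (All.lookup x∉ (∈-lookup i))
Unique⇒lookup-injective (_ ∷ u) {suc i} {suc j} eq = cong suc (Unique⇒lookup-injective u eq)

Unique⇒length≤ : ∀ {n} {xs : List (Fin n)} → Unique xs → length xs ≤ n
Unique⇒length≤ u = injective⇒≤ (Unique⇒lookup-injective u)

Unique-++⁻ˡ : ∀ {A : Set} (xs : List A) {ys} → Unique (xs ++ ys) → Unique xs
Unique-++⁻ˡ [] _ = []
Unique-++⁻ˡ (x ∷ xs) (x∉ ∷ u) = ++⁻ˡ xs x∉ ∷ Unique-++⁻ˡ xs u

Linked-chord : ∀ {A : Set} {R : Rel A 0ℓ} {x} xs {w ws z} →
               Linked R (x ∷ xs ++ w ∷ ws) → R w z → Linked R (x ∷ (xs ++ w ∷ []) ++ z ∷ [])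
Linked-chord [] (x~w ∷ _) w~z = x~w ∷ w~z ∷ [-]
Linked-chord (y ∷ xs) (x~y ∷ l) w~z = x~y ∷ Linked-chord xs l w~z

last⁺ : ∀ {A : Set} → A → List A → A
last⁺ x [] = x
last⁺ _ (y ∷ ys) = last⁺ y ys

Linked-∷ʳ⁻ : ∀ {A : Set} {R : Rel A 0ℓ} {x z} ys → Linked R (x ∷ ys ++ z ∷ []) →
             Linked R (x ∷ ys) × R (last⁺ x ys) z
Linked-∷ʳ⁻ [] (x~z ∷ [-]) = [-] , x~z
Linked-∷ʳ⁻ (y ∷ ys) (x~y ∷ linked) with Linked-∷ʳ⁻ ys linked
... | linked′ , last~z = x~y ∷ linked′ , last~z

-- A reversal a → b ← c would force a ≡ c, which uniqueness excludes.
module _ {A : Set} {E R : Rel A 0ℓ} (E⇒R± : ∀ {x y} → E x y → R x y ⊎ R y x)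
         (R-injective : ∀ {x y z} → R x z → R y z → x ≡ y) where

  Linked-keeps-direction : ∀ {a b} zs → Linked E (a ∷ b ∷ zs) → Unique (a ∷ b ∷ zs) →
                           R a b → Linked R (a ∷ b ∷ zs)
  Linked-keeps-direction [] _ _ a→b = a→b ∷ [-]
  Linked-keeps-direction (c ∷ zs) (_ ∷ linked) ((_ ∷ a≢c ∷ _) ∷ uniq) a→b
    with E⇒R± (Linked.head linked)
  ... | inj₁ b→c = a→b ∷ Linked-keeps-direction zs linked uniq b→c
  ... | inj₂ c→b = contradiction (R-injective a→b c→b) a≢c

-- The handshake lemma for trees, by pruning leaves

Adj-sym : ∀ {n} (G : Graph n) {a b} → Adj G a b → Adj G b a
Adj-sym G {a} {b} a~b = trans (Graph.sym G b a) a~b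

Adj-irrefl : ∀ {n} (G : Graph n) {a} → ¬ Adj G a a
Adj-irrefl G {a} a~a with trans (sym a~a) (irrefl G a)
... | ()

walk⇒step : ∀ {A : Set} {R : Rel A 0ℓ} {a b} → Star R a b → a ≢ b → ∃ (R a)
walk⇒step ε a≢a = contradiction refl a≢a
walk⇒step (a~v ◅ _) _ = _ , a~v

Adj⇒≢ : ∀ {n} (G : Graph n) {a b} → Adj G a b → a ≢ b
Adj⇒≢ G a~b refl = Adj-irrefl G a~b

chord⇒cycle : ∀ {n} (G : Graph n) {v u w} path → w ∈ path → Unique (v ∷ u ∷ path) →
              Linked (Adj G) (v ∷ u ∷ path) → Adj G w v → HasCycle G
chord⇒cycle G {v} {u} {w} path w∈path uniq (v~u ∷ linked) w~v with ∈-∃++ w∈path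
... | A , B , refl = v , u ∷ A ++ w ∷ [] , s≤s (length-++-≤ʳ (w ∷ []) {A}) ,
                     Unique-++⁻ˡ (v ∷ u ∷ A ++ w ∷ []) (subst Unique reassociate uniq) ,
                     v~u ∷ Linked-chord A linked w~v
  where
  reassociate : v ∷ u ∷ A ++ w ∷ B ≡ (v ∷ u ∷ A ++ w ∷ []) ++ B
  reassociate = cong (λ l → v ∷ u ∷ l) (sym (++-assoc A (w ∷ []) B))

module Induced {N : ℕ} (G : Graph N) where

  size : (Fin N → Bool) → ℕ
  size S = ∑ (𝟙 ∘ S)

  degreeIn : (Fin N → Bool) → Fin N → ℕ
  degreeIn S i = ∑ (λ j → 𝟙 (S j ∧ adj G i j))

  degreeSumIn : (Fin N → Bool) → ℕ
  degreeSumIn S = ∑ (λ i → if S i then degreeIn S i else 0)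

  _─_ : (Fin N → Bool) → Fin N → Fin N → Bool
  (S ─ ℓ) j = if does (j ≟ ℓ) then false else S j

  StepIn : (Fin N → Bool) → Fin N → Fin N → Set
  StepIn S a b = Adj G a b × S b ≡ true

  ConnectedIn : (Fin N → Bool) → Set
  ConnectedIn S = ∀ i j → S i ≡ true → S j ≡ true → Star (StepIn S) i j

  record Leaf (S : Fin N → Bool) : Set where
    field
      vertex neighbour : Fin N
      vertex∈ : S vertex ≡ true
      neighbour∈ : S neighbour ≡ true
      adjacent : Adj G vertex neighbour
      unique : ∀ x → S x ≡ true → Adj G vertex x → x ≡ neighbour

  ─-self : ∀ S ℓ → (S ─ ℓ) ℓ ≡ false
  ─-self S ℓ with ℓ ≟ ℓ
  ... | yes _ = refl
  ... | no ℓ≢ℓ = contradiction refl ℓ≢ℓ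

  ─-other : ∀ S {ℓ j} → (S ─ ℓ) j ≡ true → j ≢ ℓ × S j ≡ true
  ─-other S {ℓ} {j} j∈ with j ≟ ℓ
  ... | no j≢ℓ = j≢ℓ , j∈

  size-─ : ∀ S ℓ {n} → S ℓ ≡ true → size S ≡ suc n → size (S ─ ℓ) ≡ n
  size-─ S ℓ ℓ∈ size≡ = suc-injective (trans (sym split) size≡)
    where
    open ≡-Reasoning
    split : size S ≡ suc (size (S ─ ℓ))
    split = begin
        size S
      ≡⟨ ∑-split-at (𝟙 ∘ S) ℓ ⟩
        𝟙 (S ℓ) + ∑ (λ j → if does (j ≟ ℓ) then 0 else 𝟙 (S j))
      ≡⟨ cong₂ _+_ (cong 𝟙 ℓ∈) (sum-cong-≗ (λ j → sym (if-float 𝟙 (does (j ≟ ℓ))))) ⟩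
        suc (size (S ─ ℓ)) ∎

  degreeIn-─ : ∀ S ℓ → S ℓ ≡ true → ∀ i →
               degreeIn S i ≡ 𝟙 (adj G i ℓ) + degreeIn (S ─ ℓ) i
  degreeIn-─ S ℓ ℓ∈ i = begin
      degreeIn S i
    ≡⟨ ∑-split-at (λ j → 𝟙 (S j ∧ adj G i j)) ℓ ⟩
      𝟙 (S ℓ ∧ adj G i ℓ) + ∑ (λ j → if does (j ≟ ℓ) then 0 else 𝟙 (S j ∧ adj G i j))
    ≡⟨ cong₂ _+_ (cong (λ b → 𝟙 (b ∧ adj G i ℓ)) ℓ∈)
                 (sum-cong-≗ (λ j → sym (if-float (λ b → 𝟙 (b ∧ adj G i j)) (does (j ≟ ℓ))))) ⟩
      𝟙 (adj G i ℓ) + degreeIn (S ─ ℓ) i ∎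
    where open ≡-Reasoning

  degreeIn-─-self : ∀ S ℓ → S ℓ ≡ true → degreeIn (S ─ ℓ) ℓ ≡ degreeIn S ℓ
  degreeIn-─-self S ℓ ℓ∈ =
    sym (trans (degreeIn-─ S ℓ ℓ∈ ℓ) (cong (λ b → 𝟙 b + degreeIn (S ─ ℓ) ℓ) (irrefl G ℓ)))

  degreeSumIn-─ : ∀ S ℓ → S ℓ ≡ true →
                  degreeSumIn S ≡ degreeIn S ℓ + (degreeSumIn (S ─ ℓ) + degreeIn S ℓ)
  degreeSumIn-─ S ℓ ℓ∈ = begin
      degreeSumIn S
    ≡⟨ ∑-split-at (counted S) ℓ ⟩
      counted S ℓ + ∑ (λ i → if does (i ≟ ℓ) then 0 else counted S i)
    ≡⟨ cong₂ _+_ (cong (if_then degreeIn S ℓ else 0) ℓ∈) (sum-cong-≗ split) ⟩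
      degreeIn S ℓ + ∑ (λ i → counted (S ─ ℓ) i + 𝟙 ((S ─ ℓ) i ∧ adj G ℓ i))
    ≡⟨ cong (degreeIn S ℓ +_) (∑-distrib-+ (counted (S ─ ℓ)) (λ i → 𝟙 ((S ─ ℓ) i ∧ adj G ℓ i))) ⟩
      degreeIn S ℓ + (degreeSumIn (S ─ ℓ) + degreeIn (S ─ ℓ) ℓ)
    ≡⟨ cong (λ d → degreeIn S ℓ + (degreeSumIn (S ─ ℓ) + d)) (degreeIn-─-self S ℓ ℓ∈) ⟩
      degreeIn S ℓ + (degreeSumIn (S ─ ℓ) + degreeIn S ℓ) ∎
    where
    open ≡-Reasoning
    counted : (Fin N → Bool) → Fin N → ℕ
    counted S′ i = if S′ i then degreeIn S′ i else 0
    split : ∀ i → (if does (i ≟ ℓ) then 0 else counted S i) ≡ counted (S ─ ℓ) i + 𝟙 ((S ─ ℓ) i ∧ adj G ℓ i)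
    split i with i ≟ ℓ | S i in i∈
    ... | yes _ | _ = refl
    ... | no _ | false = refl
    ... | no _ | true = begin
        degreeIn S i
      ≡⟨ degreeIn-─ S ℓ ℓ∈ i ⟩
        𝟙 (adj G i ℓ) + degreeIn (S ─ ℓ) i
      ≡⟨ +-comm (𝟙 (adj G i ℓ)) _ ⟩
        degreeIn (S ─ ℓ) i + 𝟙 (adj G i ℓ)
      ≡⟨ cong (λ b → degreeIn (S ─ ℓ) i + 𝟙 b) (Graph.sym G i ℓ) ⟩
        degreeIn (S ─ ℓ) i + 𝟙 (adj G ℓ i) ∎

  module _ {S : Fin N → Bool} (L : Leaf S) where
    open Leaf L

    degreeIn-leaf : degreeIn S vertex ≡ 1
    degreeIn-leaf = trans (sum-cong-≗ only-neighbour) (∑-delta neighbour 1)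
      where
      only-neighbour : ∀ j → 𝟙 (S j ∧ adj G vertex j) ≡ 𝟙 (does (j ≟ neighbour))
      only-neighbour j with j ≟ neighbour | S j in j∈ | adj G vertex j in vertex~j
      ... | yes refl | true | true = refl
      ... | yes refl | false | _ = contradiction (trans (sym j∈) neighbour∈) λ ()
      ... | yes refl | true | false = contradiction (trans (sym vertex~j) adjacent) λ ()
      ... | no _ | false | _ = refl
      ... | no _ | true | false = refl
      ... | no j≢neighbour | true | true = contradiction (unique j j∈ vertex~j) j≢neighbour

    degreeSumIn-prune : degreeSumIn S ≡ 2 + degreeSumIn (S ─ vertex)
    degreeSumIn-prune = begin
        degreeSumIn S
      ≡⟨ degreeSumIn-─ S vertex vertex∈ ⟩
        degreeIn S vertex + (degreeSumIn (S ─ vertex) + degreeIn S vertex)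
      ≡⟨ cong (λ d → d + (degreeSumIn (S ─ vertex) + d)) degreeIn-leaf ⟩
        1 + (degreeSumIn (S ─ vertex) + 1)
      ≡⟨ cong suc (+-comm (degreeSumIn (S ─ vertex)) 1) ⟩
        2 + degreeSumIn (S ─ vertex) ∎
      where open ≡-Reasoning

    -- A walk in S between vertices other than the leaf enters and leaves the
    -- leaf through its unique neighbour, so that detour can be cut out.
    prune-walk : ∀ {i j} → (S ─ vertex) i ≡ true → (S ─ vertex) j ≡ true →
                 Star (StepIn S) i j → Star (StepIn (S ─ vertex)) i j
    prune-walk i∈ j∈ ε = ε
    prune-walk {i} i∈ j∈ (_◅_ {j = k} (i~k , k∈) walk) with k ≟ vertex
    ... | no k≢vertex = (i~k , k∈′) ◅ prune-walk k∈′ j∈ walk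
      where
      k∈′ : (S ─ vertex) k ≡ true
      k∈′ with k ≟ vertex
      ... | yes k≡vertex = contradiction k≡vertex k≢vertex
      ... | no _ = k∈
    ... | yes refl with walk
    ...   | ε = contradiction (trans (sym j∈) (─-self S vertex)) λ ()
    ...   | _◅_ {j = k′} (vertex~k′ , k′∈) walk′ with ─-other S i∈
    ...     | _ , i∈S
            with trans (unique k′ k′∈ vertex~k′) (sym (unique i i∈S (Adj-sym G i~k)))
    ...       | refl = prune-walk i∈ j∈ walk′

    connectedIn-prune : ConnectedIn S → ConnectedIn (S ─ vertex)
    connectedIn-prune connected i j i∈ j∈ =
      prune-walk i∈ j∈ (connected i j (proj₂ (─-other S i∈)) (proj₂ (─-other S j∈)))

  size≡1⇒unique-member : ∀ S → size S ≡ 1 →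
                         ∀ {i j} → S i ≡ true → S j ≡ true → i ≡ j
  size≡1⇒unique-member S size≡1 {i} {j} i∈ j∈ with i ≟ j
  ... | yes i≡j = i≡j
  ... | no i≢j with subst (_≤ 1) (cong₂ (λ a b → 𝟙 a + 𝟙 b) i∈ j∈)
                        (subst (𝟙 (S i) + 𝟙 (S j) ≤_) size≡1 (∑-two-points (𝟙 ∘ S) i≢j))
  ...   | s≤s ()

  degreeSumIn-singleton : ∀ S → size S ≡ 1 → degreeSumIn S ≡ 0
  degreeSumIn-singleton S size≡1 = ∑-zero isolated
    where
    isolated : ∀ i → (if S i then degreeIn S i else 0) ≡ 0
    isolated i with S i in i∈
    ... | false = refl
    ... | true = ∑-zero no-neighbour
      where
      no-neighbour : ∀ j → 𝟙 (S j ∧ adj G i j) ≡ 0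
      no-neighbour j with S j in j∈ | adj G i j in i~j
      ... | false | _ = refl
      ... | true | false = refl
      ... | true | true = contradiction (size≡1⇒unique-member S size≡1 i∈ j∈) (Adj⇒≢ G i~j)

  two-members : ∀ S {k} → size S ≡ 2 + k →
                ∃₂ λ s t → t ≢ s × S s ≡ true × S t ≡ true
  two-members S size≡ with ∑-positive (𝟙 ∘ S) (subst (0 <_) (sym size≡) (s≤s z≤n))
  ... | s , 0<s with 𝟙-positive (S s) 0<s
  ...   | s∈ with ∑-positive (𝟙 ∘ (S ─ s)) (subst (0 <_) (sym (size-─ S s s∈ size≡)) (s≤s z≤n))
  ...     | t , 0<t with ─-other S (𝟙-positive ((S ─ s) t) 0<t)
  ...       | t≢s , t∈ = s , t , t≢s , s∈ , t∈

  module _ (acyclic : ¬ HasCycle G) where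
    open import Data.List.Membership.DecPropositional (_≟_ {N}) using (_∈?_)

    -- Grow a path v ∷ u ∷ … inside S at v until v has no other neighbour in S:
    -- a neighbour already on the path would close a cycle, and Unique⇒length≤
    -- bounds the number of growth steps.
    extend-to-leaf : ∀ {S} fuel {v u} path → N < fuel + length (v ∷ u ∷ path) →
                     Unique (v ∷ u ∷ path) → Linked (Adj G) (v ∷ u ∷ path) →
                     S v ≡ true → S u ≡ true → Leaf S
    extend-to-leaf zero path long uniq _ _ _ = contradiction (Unique⇒length≤ uniq) (<⇒≱ long)
    extend-to-leaf {S} (suc fuel) {v} {u} path long uniq linked@(v~u ∷ _) v∈ u∈
      with any? (λ w → (S w Bool.≟ true) ×-dec (adj G v w Bool.≟ true) ×-dec ¬? (w ≟ u))
    ... | no no-other = record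
      { vertex = v ; neighbour = u ; vertex∈ = v∈ ; neighbour∈ = u∈ ; adjacent = v~u
      ; unique = λ x x∈ v~x →
          decidable-stable (x ≟ u) (λ x≢u → no-other (x , x∈ , v~x , x≢u)) }
    ... | yes (w , w∈ , v~w , w≢u) with w ∈? (v ∷ u ∷ path)
    ...   | no w∉ = extend-to-leaf fuel (u ∷ path) (subst (N <_) (sym (+-suc fuel _)) long)
                      (¬Any⇒All¬ _ w∉ ∷ uniq) (Adj-sym G v~w ∷ linked) w∈ v∈
    ...   | yes (here refl) = contradiction v~w (Adj-irrefl G)
    ...   | yes (there (here refl)) = contradiction refl w≢u
    ...   | yes (there (there w∈path)) =
      contradiction (chord⇒cycle G path w∈path uniq linked (Adj-sym G v~w)) acyclic

    leaf-exists : ∀ S {k} → size S ≡ 2 + k → ConnectedIn S → Leaf S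
    leaf-exists S size≡ connected with two-members S size≡
    ... | s , t , t≢s , s∈ , t∈ with walk⇒step (connected s t s∈ t∈) (t≢s ∘ sym)
    ...   | v , s~v , v∈ =
      extend-to-leaf N [] (m<m+n N (s≤s z≤n))
        ((Adj⇒≢ G (Adj-sym G s~v) ∷ []) ∷ [] ∷ []) (Adj-sym G s~v ∷ [-]) v∈ s∈

    degreeSumIn-tree : ∀ k S → size S ≡ suc k → ConnectedIn S → degreeSumIn S ≡ 2 * k
    degreeSumIn-tree zero S size≡1 _ = degreeSumIn-singleton S size≡1
    degreeSumIn-tree (suc k) S size≡ connected = begin
        degreeSumIn S
      ≡⟨ degreeSumIn-prune L ⟩
        2 + degreeSumIn (S ─ vertex)
      ≡⟨ cong (2 +_) (degreeSumIn-tree k (S ─ vertex) (size-─ S vertex vertex∈ size≡)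
                                        (connectedIn-prune L connected)) ⟩
        2 + 2 * k
      ≡⟨ *-suc 2 k ⟨
        2 * suc k ∎
      where
      open ≡-Reasoning
      L = leaf-exists S size≡ connected
      open Leaf L using (vertex; vertex∈)

degrees : ∀ {n} → Graph n → List ℕ
degrees {n} G = map (degree G) (allFin n)

H≡∏selfPow-degrees : ∀ {n} (G : Graph n) → H G ≡ ∏selfPow (degrees G)
H≡∏selfPow-degrees {n} G = cong product (map-∘ (allFin n))

leaves≡ones-degrees : ∀ {n} (G : Graph n) → leaves G ≡ ones (degrees G)
leaves≡ones-degrees {n} G = cong sum (map-∘ (allFin n))

length-degrees : ∀ {n} (G : Graph n) → length (degrees G) ≡ n
length-degrees {n} G = trans (length-map (degree G) (allFin n)) (length-tabulate id)

All-degrees : ∀ {n} {P : ℕ → Set} (G : Graph n) →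
              (∀ i → P (degree G i)) → All P (degrees G)
All-degrees G P-degree = map⁺ (tabulate⁺ P-degree)

degree≡∑ : ∀ {n} (G : Graph n) i → degree G i ≡ ∑ (λ j → 𝟙 (adj G i j))
degree≡∑ G i = sum-allFin (λ j → 𝟙 (adj G i j))

sum-degrees-tree : ∀ {m} (T : Graph (suc m)) → IsTree T → sum (degrees T) ≡ 2 * m
sum-degrees-tree {m} T (connected , acyclic) = begin
    sum (degrees T)
  ≡⟨ sum-allFin (degree T) ⟩
    ∑ (degree T)
  ≡⟨ sum-cong-≗ (degree≡∑ T) ⟩
    degreeSumIn (λ _ → true)
  ≡⟨ degreeSumIn-tree acyclic m (λ _ → true) (∑-const-1 (suc m))
       (λ i j _ _ → gmap id (_, refl) (connected i j)) ⟩
    2 * m ∎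
  where
  open Induced T
  open ≡-Reasoning

another-vertex : ∀ {m} (i : Fin (suc (suc m))) → ∃ λ j → i ≢ j
another-vertex zero = suc zero , λ ()
another-vertex (suc i) = zero , λ ()

degree-positive : ∀ {m} (T : Graph (suc (suc m))) → Connected T → ∀ i → 1 ≤ degree T i
degree-positive T connected i with another-vertex i
... | j , i≢j with walk⇒step (connected i j) i≢j
...   | v , i~v = subst (1 ≤_) (sym (degree≡∑ T i))
                    (subst (λ b → 𝟙 b ≤ ∑ (𝟙 ∘ adj T i)) i~v (∑-point (𝟙 ∘ adj T i) v))

excess-degrees-tree : ∀ {m} (T : Graph (suc (suc m))) → IsTree T → excess (degrees T) ≡ m
excess-degrees-tree {m} T tree@(connected , _) = +-cancelʳ-≡ (2 + m) (excess (degrees T)) m (begin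
    excess (degrees T) + (2 + m)
  ≡⟨ cong (excess (degrees T) +_) (length-degrees T) ⟨
    excess (degrees T) + length (degrees T)
  ≡⟨ sum≡excess+length (degrees T) (All-degrees T (degree-positive T connected)) ⟨
    sum (degrees T)
  ≡⟨ sum-degrees-tree T tree ⟩
    2 * (1 + m)
  ≡⟨ double m ⟩
    m + (2 + m) ∎)
  where
  open ≡-Reasoning
  double : ∀ m → 2 * (1 + m) ≡ m + (2 + m)
  double = solve-∀

module _ {m} (T : Graph (suc (suc m))) (tree : IsTree T) where

  private
    ds : List ℕ
    ds = degrees T

    positive : Positive ds
    positive = All-degrees T (degree-positive T (proj₁ tree))

    excess≡m : excess ds ≡ m
    excess≡m = excess-degrees-tree T tree

  H-tree≤selfPow : H T ≤ selfPow (suc m)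
  H-tree≤selfPow = begin
      H T                         ≡⟨ H≡∏selfPow-degrees T ⟩
      ∏selfPow ds                 ≤⟨ ∏selfPow≤selfPow[1+excess] ds positive ⟩
      selfPow (suc (excess ds))   ≡⟨ cong (selfPow ∘ suc) excess≡m ⟩
      selfPow (suc m)             ∎
    where open ≤-Reasoning

  4^m≤H-tree : 4 ^ m ≤ H T
  4^m≤H-tree = begin
      4 ^ m            ≡⟨ cong (4 ^_) excess≡m ⟨
      4 ^ excess ds    ≤⟨ 4^excess≤∏selfPow ds positive ⟩
      ∏selfPow ds      ≡⟨ H≡∏selfPow-degrees T ⟨
      H T              ∎
    where open ≤-Reasoning

  H-tree≤4^m : All (_≤ 2) (degrees T) → H T ≤ 4 ^ m
  H-tree≤4^m ds≤2 = begin
      H T              ≡⟨ H≡∏selfPow-degrees T ⟩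
      ∏selfPow ds      ≤⟨ ∏selfPow≤4^excess ds ds≤2 ⟩
      4 ^ excess ds    ≡⟨ cong (4 ^_) excess≡m ⟩
      4 ^ m            ∎
    where open ≤-Reasoning

  27*4^m≤16*H-tree : Any (3 ≤_) (degrees T) → 27 * 4 ^ m ≤ 16 * H T
  27*4^m≤16*H-tree branching = begin
      27 * 4 ^ m           ≡⟨ cong (λ e → 27 * 4 ^ e) excess≡m ⟨
      27 * 4 ^ excess ds   ≤⟨ 27*4^excess≤16*∏selfPow ds positive branching ⟩
      16 * ∏selfPow ds     ≡⟨ cong (16 *_) (H≡∏selfPow-degrees T) ⟨
      16 * H T             ∎
    where open ≤-Reasoning

  H-tree-dichotomy : H T ≤ 4 ^ m ⊎ 27 * 4 ^ m ≤ 16 * H T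
  H-tree-dichotomy with all? (_≤? 2) ds
  ... | yes ds≤2 = inj₁ (H-tree≤4^m ds≤2)
  ... | no ¬ds≤2 = inj₂ (27*4^m≤16*H-tree (Any.map ≰⇒> (¬All⇒Any¬ (_≤? 2) ds ¬ds≤2)))

  module _ (three-leaves : leaves T ≡ 3) where

    private
      excess₂≡1 : excess₂ ds ≡ 1
      excess₂≡1 = +-cancelʳ-≡ (2 + m) (excess₂ ds) 1 (begin
          excess₂ ds + (2 + m)           ≡⟨ cong (excess₂ ds +_) (length-degrees T) ⟨
          excess₂ ds + length ds         ≡⟨ excess+ones≡excess₂+length ds positive ⟨
          excess ds + ones ds            ≡⟨ cong₂ _+_ excess≡m ones≡3 ⟩
          m + 3                          ≡⟨ +-comm m 3 ⟩
          1 + (2 + m)                    ∎)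
        where
        open ≡-Reasoning
        ones≡3 : ones ds ≡ 3
        ones≡3 = trans (sym (leaves≡ones-degrees T)) three-leaves

    16*H-three-leaves≤27*4^m : 16 * H T ≤ 27 * 4 ^ m
    16*H-three-leaves≤27*4^m = begin
        16 * H T             ≡⟨ cong (16 *_) (H≡∏selfPow-degrees T) ⟩
        16 * ∏selfPow ds     ≤⟨ 16*∏selfPow≤27*4^excess ds excess₂≡1 ⟩
        27 * 4 ^ excess ds   ≡⟨ cong (λ e → 27 * 4 ^ e) excess≡m ⟩
        27 * 4 ^ m           ∎
      where open ≤-Reasoning

    27*4^m≤16*H-three-leaves : 27 * 4 ^ m ≤ 16 * H T
    27*4^m≤16*H-three-leaves = 27*4^m≤16*H-tree (excess₂≡1⇒Any3≤ ds excess₂≡1)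

-- Stars and paths

star-connected : ∀ m → Connected (star m)
star-connected m i j = to-centre i ◅◅ from-centre j
  where
  from-centre : ∀ j → Star (Adj (star m)) zero j
  from-centre zero = ε
  from-centre (suc j) = refl ◅ ε
  to-centre : ∀ i → Star (Adj (star m)) i zero
  to-centre zero = ε
  to-centre (suc i) = refl ◅ ε

star-leaf≁leaf : ∀ {m} (a b : Fin m) → ¬ Adj (star m) (suc a) (suc b)
star-leaf≁leaf a b a~b with trans (sym a~b) (∧-zeroʳ (not (suc (toℕ a) ≡ᵇ suc (toℕ b))))
... | ()

star-middle≡centre : ∀ {m} {a b c : Fin (suc m)} →
                     Adj (star m) a b → Adj (star m) b c → a ≢ c → b ≡ zero
star-middle≡centre {b = zero} _ _ _ = refl
star-middle≡centre {a = zero} {suc b} {zero} _ _ a≢c = contradiction refl a≢c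
star-middle≡centre {a = zero} {suc b} {suc c} _ b~c _ = contradiction b~c (star-leaf≁leaf b c)
star-middle≡centre {a = suc a} {suc b} a~b _ _ = contradiction a~b (star-leaf≁leaf a b)

star-acyclic : ∀ m → ¬ HasCycle (star m)
star-acyclic m (_ , [] , () , _)
star-acyclic m (_ , _ ∷ [] , s≤s () , _)
star-acyclic m (x , y ∷ y′ ∷ [] , _ , (x≢y ∷ x≢y′ ∷ []) ∷ (y≢y′ ∷ []) ∷ _ , x~y ∷ y~y′ ∷ y′~x ∷ [-]) =
  y≢y′ (trans (star-middle≡centre x~y y~y′ x≢y′) (sym (star-middle≡centre y~y′ y′~x (x≢y ∘ sym))))
star-acyclic m (x , y ∷ y′ ∷ y″ ∷ _ , _ , (_ ∷ x≢y′ ∷ _) ∷ (y≢y′ ∷ y≢y″ ∷ _) ∷ _ ,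
                x~y ∷ y~y′ ∷ y′~y″ ∷ _) =
  y≢y′ (trans (star-middle≡centre x~y y~y′ x≢y′) (sym (star-middle≡centre y~y′ y′~y″ y≢y″)))

star-tree : ∀ m → IsTree (star m)
star-tree m = star-connected m , star-acyclic m

degree-star-centre : ∀ m → degree (star m) zero ≡ m
degree-star-centre m = trans (degree≡∑ (star m) zero) (∑-const-1 m)

selfPow≤H-star : ∀ m → selfPow m ≤ H (star m)
selfPow≤H-star m = begin
    selfPow m
  ≡⟨ *-identityʳ (selfPow m) ⟨
    selfPow m * 1
  ≤⟨ *-monoʳ-≤ (selfPow m) (1≤∏selfPow degrees′) ⟩
    selfPow m * ∏selfPow degrees′
  ≡⟨ cong (λ d → selfPow d * ∏selfPow degrees′) (degree-star-centre m) ⟨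
    ∏selfPow (degrees (star m))
  ≡⟨ H≡∏selfPow-degrees (star m) ⟨
    H (star m) ∎
  where
  open ≤-Reasoning
  degrees′ : List ℕ
  degrees′ = map (degree (star m)) (tabulate suc)

path-from-0 : ∀ m (i : Fin (suc m)) → Star (Adj (path m)) zero i
path-from-0 m zero = ε
path-from-0 (suc m) (suc i) = refl ◅ gmap suc id (path-from-0 m i)

path-connected : ∀ m → Connected (path m)
path-connected m i j =
  reverse (λ {a} {b} → Adj-sym (path m) {a} {b}) (path-from-0 m i) ◅◅ path-from-0 m j

Next : ∀ {n} → Fin n → Fin n → Set
Next a b = suc (toℕ a) ≡ toℕ b

path-step : ∀ {m} {a b : Fin (suc m)} → Adj (path m) a b → Next a b ⊎ Next b a
path-step {a = a} {b} a~b with suc (toℕ a) ≡ᵇ toℕ b in a→b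
... | true = inj₁ (≡ᵇ⇒≡ (suc (toℕ a)) (toℕ b) (subst T (sym a→b) tt))
... | false = inj₂ (≡ᵇ⇒≡ (suc (toℕ b)) (toℕ a) (subst T (sym a~b) tt))

Next-injective : ∀ {n} {a b c : Fin n} → Next a c → Next b c → a ≡ b
Next-injective a→c b→c = toℕ-injective (suc-injective (trans a→c (sym b→c)))

Next-functional : ∀ {n} {a b c : Fin n} → Next c a → Next c b → a ≡ b
Next-functional c→a c→b = toℕ-injective (trans (sym c→a) c→b)

Linked-Next⇒toℕ-last : ∀ {n} {x : Fin n} ys → Linked Next (x ∷ ys) →
                       toℕ (last⁺ x ys) ≡ length ys + toℕ x
Linked-Next⇒toℕ-last [] [-] = refl
Linked-Next⇒toℕ-last {x = x} (y ∷ ys) (x→y ∷ linked) =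
  trans (Linked-Next⇒toℕ-last ys linked)
        (trans (cong (length ys +_) (sym x→y)) (+-suc (length ys) (toℕ x)))

Linked-Next⁻¹⇒toℕ-last : ∀ {n} {x : Fin n} ys → Linked (flip Next) (x ∷ ys) →
                         toℕ x ≡ length ys + toℕ (last⁺ x ys)
Linked-Next⁻¹⇒toℕ-last [] [-] = refl
Linked-Next⁻¹⇒toℕ-last (y ∷ ys) (y→x ∷ linked) =
  trans (sym y→x) (cong suc (Linked-Next⁻¹⇒toℕ-last ys linked))

far-apart⇒¬Next± : ∀ {n} {a b : Fin n} k → toℕ b ≡ suc (suc k) + toℕ a →
                   ¬ (Next a b ⊎ Next b a)
far-apart⇒¬Next± {a = a} k far (inj₁ a→b) = m≢1+n+m (toℕ a) (suc-injective (trans a→b far))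
far-apart⇒¬Next± {a = a} k far (inj₂ b→a) = m≢1+n+m (toℕ a) (trans (sym b→a) (cong suc far))

path-acyclic : ∀ m → ¬ HasCycle (path m)
path-acyclic m (_ , [] , () , _)
path-acyclic m (_ , _ ∷ [] , s≤s () , _)
path-acyclic m (x , ys@(y ∷ y′ ∷ zs) , _ , uniq , closed) with Linked-∷ʳ⁻ ys closed
... | linked@(x~y ∷ _) , last~x with path-step x~y
...   | inj₁ x→y = far-apart⇒¬Next± (length zs)
                     (Linked-Next⇒toℕ-last ys
                        (Linked-keeps-direction path-step Next-injective (y′ ∷ zs) linked uniq x→y))
                     (swap (path-step last~x))
...   | inj₂ y→x = far-apart⇒¬Next± (length zs)
                     (Linked-Next⁻¹⇒toℕ-last ys
                        (Linked-keeps-direction (swap ∘ path-step) Next-functional (y′ ∷ zs) linked uniq y→x))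
                     (path-step last~x)

path-tree : ∀ m → IsTree (path m)
path-tree m = path-connected m , path-acyclic m

∑-𝟙[k≡ᵇtoℕ]≤1 : ∀ n k → ∑ {n} (λ j → 𝟙 (k ≡ᵇ toℕ j)) ≤ 1
∑-𝟙[k≡ᵇtoℕ]≤1 zero k = z≤n
∑-𝟙[k≡ᵇtoℕ]≤1 (suc n) zero = s≤s (≤-reflexive (∑-zero {n} {λ _ → 0} (λ _ → refl)))
∑-𝟙[k≡ᵇtoℕ]≤1 (suc n) (suc k) = ∑-𝟙[k≡ᵇtoℕ]≤1 n k

𝟙-∨ : ∀ a b → 𝟙 (a ∨ b) ≤ 𝟙 a + 𝟙 b
𝟙-∨ true b = s≤s z≤n
𝟙-∨ false b = ≤-refl

degree-path≤2 : ∀ m i → degree (path m) i ≤ 2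
degree-path≤2 m i = begin
    degree (path m) i
  ≡⟨ degree≡∑ (path m) i ⟩
    ∑ (λ j → 𝟙 (right j ∨ left j))
  ≤⟨ ∑-mono-≤ (λ j → 𝟙-∨ (right j) (left j)) ⟩
    ∑ (λ j → 𝟙 (right j) + 𝟙 (left j))
  ≡⟨ ∑-distrib-+ (𝟙 ∘ right) (𝟙 ∘ left) ⟩
    ∑ (𝟙 ∘ right) + ∑ (𝟙 ∘ left)
  ≤⟨ +-mono-≤ (∑-𝟙[k≡ᵇtoℕ]≤1 (suc m) (suc (toℕ i))) (left≤1 (toℕ i)) ⟩
    2 ∎
  where
  open ≤-Reasoning
  right left : Fin (suc m) → Bool
  right j = suc (toℕ i) ≡ᵇ toℕ j
  left j = suc (toℕ j) ≡ᵇ toℕ i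
  left≤1 : ∀ k → ∑ {suc m} (λ j → 𝟙 (suc (toℕ j) ≡ᵇ k)) ≤ 1
  left≤1 zero = subst (_≤ 1) (sym (∑-zero {suc m} {λ _ → 0} (λ _ → refl))) z≤n
  left≤1 (suc k) =
    subst (_≤ 1) (sum-cong-≗ {suc m} (λ j → cong 𝟙 (≡ᵇ-sym k (toℕ j)))) (∑-𝟙[k≡ᵇtoℕ]≤1 (suc m) k)

H-path≤4^m : ∀ m → H (path (suc m)) ≤ 4 ^ m
H-path≤4^m m =
  H-tree≤4^m (path (suc m)) (path-tree (suc m)) (All-degrees (path (suc m)) (degree-path≤2 (suc m)))

-- Extremal trees

degree-single-vertex : (G : Graph 1) → degree G zero ≡ 0
degree-single-vertex G = cong (λ b → 𝟙 b + 0) (irrefl G zero)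

H-single-vertex : (G : Graph 1) → H G ≡ 1
H-single-vertex G = cong (λ d → d ^ d * 1) (degree-single-vertex G)

leaves-single-vertex : (G : Graph 1) → leaves G ≡ 0
leaves-single-vertex G = cong (λ d → (if d ≡ᵇ 1 then 1 else 0) + 0) (degree-single-vertex G)

star-maximises-H : ∀ m (T : Graph (suc m)) → IsTree T → H T ≤ H (star m)
star-maximises-H zero T _ = ≤-reflexive (trans (H-single-vertex T) (sym (H-single-vertex (star 0))))
star-maximises-H (suc m) T tree = ≤-trans (H-tree≤selfPow T tree) (selfPow≤H-star (suc m))

path-minimises-H : ∀ m (T : Graph (suc m)) → IsTree T → H (path m) ≤ H T
path-minimises-H zero T _ = ≤-reflexive (trans (H-single-vertex (path 0)) (sym (H-single-vertex T)))
path-minimises-H (suc m) T tree = ≤-trans (H-path≤4^m m) (4^m≤H-tree T tree)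

three-leaves-second-smallest-H : ∀ m (T : Graph (suc m)) → IsTree T → leaves T ≡ 3 →
  H (path m) < H T
  × (∀ (T′ : Graph (suc m)) → IsTree T′ → H (path m) < H T′ → H T ≤ H T′)
three-leaves-second-smallest-H zero T _ three =
  contradiction (trans (sym three) (leaves-single-vertex T)) λ ()
three-leaves-second-smallest-H (suc m) T tree three = path<T , T≤above-path
  where
  16*4^m<27*4^m : 16 * 4 ^ m < 27 * 4 ^ m
  16*4^m<27*4^m = *-monoˡ-< (4 ^ m) {{m^n≢0 4 m}} (m≤m+n 17 10)
  path<T : H (path (suc m)) < H T
  path<T = ≤-<-trans (H-path≤4^m m)
    (*-cancelˡ-< 16 (4 ^ m) (H T) (<-≤-trans 16*4^m<27*4^m (27*4^m≤16*H-three-leaves T tree three)))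
  T≤above-path : ∀ (T′ : Graph (suc (suc m))) → IsTree T′ → H (path (suc m)) < H T′ → H T ≤ H T′
  T≤above-path T′ tree′ path<T′ with H-tree-dichotomy T′ tree′
  ... | inj₁ T′≤4^m =
    contradiction (≤-trans T′≤4^m (4^m≤H-tree (path (suc m)) (path-tree (suc m)))) (<⇒≱ path<T′)
  ... | inj₂ branching = *-cancelˡ-≤ 16 (≤-trans (16*H-three-leaves≤27*4^m T tree three) branching)

proposition7 : (m : ℕ) →
    IsTree (star m) × IsTree (path m)
    × (∀ (T : Graph (suc m)) → IsTree T → H T ≤ H (star m))
    × (∀ (T : Graph (suc m)) → IsTree T → H (path m) ≤ H T)
    × (∀ (T : Graph (suc m)) → IsTree T → leaves T ≡ 3 →
         H (path m) < H T
         × (∀ (T′ : Graph (suc m)) → IsTree T′ → H (path m) < H T′ → H T ≤ H T′))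
proposition7 m =
  star-tree m , path-tree m , star-maximises-H m , path-minimises-H m , three-leaves-second-smallest-H m
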